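{- Fix a rational number $0<\varepsilon<1$ and an integer $k\ge2$ with $\frac{1}{1-\varepsilon}\le k\le\frac{2}{1-\varepsilon}$. Let $p$ be an odd prime and $m$ a positive integer such that $\frac12(1-\varepsilon)km$ is an integer, and let $q=p^{km}$. Then there exists a set $E\subset\mathbb{F}_q^2$ such that \[ K_E=q^{1-\varepsilon},\qquad |E|=q^{\frac32-\frac{3\varepsilon}{2}}=\frac{q\,K_E^{1/2}}{q^{\varepsilon}},\qquad |\Delta_P(E)|=q^{1-\varepsilon} \] (in particular $|\Delta_P(E)|=o(q)$).
   Context: For $\mathbf{x}=(x_1,x_2),\mathbf{y}=(y_1,y_2)\in\mathbb{F}_q^2$, the parabolic distance is $\|\mathbf{x}-\mathbf{y}\|_P:=(x_2-y_2)+(x_1-y_1)^2\in\mathbb{F}_q$; $\Delta_P(E):=\{\|\mathbf{x}-\mathbf{y}\|_P:\mathbf{x},\mathbf{y}\in E\}$; $K_E:=\max_{x\in\mathbb{F}_q}|E\cap(\{x\}\times\mathbb{F}_q)|$. -}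

module Defs where

open import Level using (0ℓ)
open import Data.Nat using (ℕ; _≤_)
open import Data.Fin using (Fin)
open import Data.Product using (Σ; ∃; _×_; _,_; proj₁; proj₂)
open import Relation.Nullary using (¬_)
open import Relation.Binary.PropositionalEquality using (_≡_)
open import Algebra.Bundles using (CommutativeRing)

IsField : CommutativeRing 0ℓ 0ℓ → Set
IsField R = ¬ (1# ≈ 0#) × (∀ x → ¬ (x ≈ 0#) → ∃ λ y → x * y ≈ 1#)
  where open CommutativeRing R

HasCard : (R : CommutativeRing 0ℓ 0ℓ) → ℕ → Set
HasCard R q = Σ (Fin q → Carrier) λ v →
  (∀ i j → v i ≈ v j → i ≡ j) × (∀ x → ∃ λ i → x ≈ v i)
  where open CommutativeRing R

HasSize : {A : Set} → (A → A → Set) → (A → Set) → ℕ → Set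
HasSize {A} _≈_ P n = Σ (Fin n → A) λ v →
  (∀ i → P (v i)) × (∀ i j → v i ≈ v j → i ≡ j) × (∀ a → P a → ∃ λ i → a ≈ v i)

module Plane (R : CommutativeRing 0ℓ 0ℓ) where
  open CommutativeRing R

  Pt : Set
  Pt = Carrier × Carrier

  _≈Pt_ : Pt → Pt → Set
  (a , b) ≈Pt (c , d) = (a ≈ c) × (b ≈ d)

  Respects : (Pt → Set) → Set
  Respects E = ∀ x y → x ≈Pt y → E x → E y

  parDist : Pt → Pt → Carrier
  parDist (x₁ , x₂) (y₁ , y₂) = (x₂ - y₂) + ((x₁ - y₁) * (x₁ - y₁))

  ΔP : (Pt → Set) → Carrier → Set
  ΔP E t = ∃ λ x → ∃ λ y → E x × E y × (parDist x y ≈ t)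

  Column : (Pt → Set) → Carrier → Carrier → Set
  Column E x y = E (x , y)

  MaxColumn : (Pt → Set) → ℕ → Set
  MaxColumn E K =
    (∀ x n → HasSize _≈_ (Column E x) n → n ≤ K) ×
    (∃ λ x → HasSize _≈_ (Column E x) K)

{-# OPTIONS --safe #-}
-- F has prime characteristic r and is a vector space over its prime field F_r, so q = r^D and
-- r = p. If 1, θ, …, θ^(n−1) are dependent over F_r, θ is a root of one of the p^n polynomials
-- with n coefficients in F_r that are not all zero, each of which has at most n − 1 roots; since
-- p^n (n − 1) < p^(2n) ≤ q, some θ has independent powers. Let A be their span (p^n elements)
-- and H a 2n-dimensional subspace containing 1, θ, …, θ^(2n−1), hence A·A. For E = A × H each
-- nonempty column is a copy of H, |E| = p^(3n), and Δ_P(E) = H: the distance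
-- (x₂ − y₂) + (x₁ − y₁)² lies in H, and (0, t), (0, 0) are at distance t. The hypothesis
-- (1 − ε)k ≤ 2 gives n ≤ m, hence 2n ≤ km.
module Submission where

open import Level using (0ℓ)
open import Algebra.Bundles using (CommutativeRing)
open import Data.Nat as ℕ using (ℕ; zero; suc; _∸_; _≤_; _^_; z≤n; s≤s; z<s)
import Data.Nat.Properties as ℕ
open import Data.Nat.Coprimality as Coprimality using (Coprime; 1-coprimeTo; coprime-Bézout)
open import Data.Nat.DivMod using (_%_; m≡m%n+[m/n]*n; m%n<n)
open import Data.Nat.Divisibility using (_∣_; divides; _∣?_; ∣-refl; >⇒∤; ∣1⇒≡1; m∣m*n)
open import Data.Nat.GCD using (module Bézout)
open import Data.Nat.Induction using (<-rec)
open import Data.Nat.Primality using (Prime; prime?; ¬prime[1]; euclidsLemma; prime⇒irreducible; prime⇒nonZero; prime⇒nonTrivial; ¬prime⇒composite; composite)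
open import Data.Integer as ℤ using (+_)
import Data.Integer.Properties as ℤ
open import Data.Fin as Fin using (Fin; zero; suc; toℕ; fromℕ<; combine; inject≤; finToFun; funToFin)
import Data.Fin.Properties as Fin
open import Data.List using (List; length; filter; allFin; lookup)
open import Data.List.Membership.Propositional using (_∈_)
open import Data.List.Membership.Propositional.Properties using (∈-filter⁺; ∈-filter⁻; ∈-allFin; ∈-lookup)
open import Data.List.Membership.Setoid.Properties using (index-injective)
import Data.List.Relation.Unary.All as All
open import Data.List.Relation.Unary.Any using (index)
import Data.List.Relation.Unary.AllPairs as AllPairs
open import Data.List.Relation.Unary.Unique.Propositional using (Unique)
import Data.List.Relation.Unary.Unique.Propositional.Properties as Unique
open import Data.Vec.Functional using (_∷_)
open import Data.Product using (∃; ∃₂; _×_; _,_; proj₁; proj₂)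
open import Data.Sum using (_⊎_; inj₁; inj₂; [_,_]′)
open import Data.Unit using (⊤; tt)
open import Data.Empty using (⊥-elim)
open import Function using (_∘_; id)
open import Function.Definitions using (Injective)
open import Relation.Nullary using (¬_; Dec; yes; no; contradiction)
open import Relation.Nullary.Decidable using (_×-dec_; ¬?)
open import Relation.Binary.Bundles using (Setoid)
open import Relation.Binary.Definitions using (Decidable)
open import Relation.Binary.PropositionalEquality as ≡ using (_≡_; _≢_; _≗_; refl)
open import Defs

lookup-injective : ∀ {A : Set} {xs : List A} → Unique xs → Injective _≡_ _≡_ (lookup xs)
lookup-injective (_ AllPairs.∷ _) {zero} {zero} _ = refl
lookup-injective (x∉ AllPairs.∷ _) {zero} {suc j} x≡ = ⊥-elim (All.lookup x∉ (∈-lookup j) x≡)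
lookup-injective (x∉ AllPairs.∷ _) {suc i} {zero} ≡x = ⊥-elim (All.lookup x∉ (∈-lookup i) (≡.sym ≡x))
lookup-injective (_ AllPairs.∷ u) {suc i} {suc j} eq = ≡.cong suc (lookup-injective u eq)

fibre-bound : ∀ {a b c} (f : Fin a → Fin b) →
  (∀ (g : Fin (suc c) → Fin a) → Injective _≡_ _≡_ g → ¬ (∀ i → f (g i) ≡ f (g zero))) →
  a ≤ b ℕ.* c
fibre-bound {a} {b} {c} f no-large-fibre = Fin.injective⇒≤ position-injective
  where
  fibre : Fin b → List (Fin a)
  fibre y = filter (λ x → f x Fin.≟ y) (allFin a)

  own-fibre : ∀ x → x ∈ fibre (f x)
  own-fibre x = ∈-filter⁺ (λ x′ → f x′ Fin.≟ f x) (∈-allFin x) refl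

  fibre-length : ∀ y → length (fibre y) ≤ c
  fibre-length y with length (fibre y) ℕ.≤? c
  ... | yes small = small
  ... | no large = ⊥-elim (no-large-fibre g g-injective (λ i → ≡.trans (in-fibre i) (≡.sym (in-fibre zero))))
    where
    c<len : suc c ≤ length (fibre y)
    c<len = ℕ.≰⇒> large
    g : Fin (suc c) → Fin a
    g i = lookup (fibre y) (inject≤ i c<len)
    g-injective : Injective _≡_ _≡_ g
    g-injective eq = Fin.inject≤-injective c<len c<len _ _
      (lookup-injective (Unique.filter⁺ (λ x → f x Fin.≟ y) (Unique.allFin⁺ a)) eq)
    in-fibre : ∀ i → f (g i) ≡ y
    in-fibre i = proj₂ (∈-filter⁻ (λ x → f x Fin.≟ y) {xs = allFin a} (∈-lookup (inject≤ i c<len)))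

  position : Fin a → Fin (b ℕ.* c)
  position x = combine (f x) (inject≤ (index (own-fibre x)) (fibre-length (f x)))

  position-injective : Injective _≡_ _≡_ position
  position-injective {x} {x′} eq with fx≡fx′ , same-index ← Fin.combine-injective (f x) _ (f x′) _ eq =
    same-fibre fx≡fx′ (own-fibre x) (own-fibre x′)
      (≡.trans (≡.sym (Fin.toℕ-inject≤ _ _)) (≡.trans (≡.cong toℕ same-index) (Fin.toℕ-inject≤ _ _)))
    where
    same-fibre : ∀ {y y′ x x′} → y ≡ y′ → (p : x ∈ fibre y) (p′ : x′ ∈ fibre y′) →
                 toℕ (index p) ≡ toℕ (index p′) → x ≡ x′
    same-fibre refl p p′ e = index-injective (≡.setoid _) p p′ (Fin.toℕ-injective e)

funToFin-cong : ∀ {m n} {f g : Fin m → Fin n} → f ≗ g → funToFin f ≡ funToFin g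
funToFin-cong {zero} f≗g = refl
funToFin-cong {suc m} f≗g = ≡.cong₂ combine (f≗g zero) (funToFin-cong (f≗g ∘ suc))

finToFun-injective : ∀ {m n} {k k′ : Fin (m ^ n)} → finToFun {m} {n} k ≗ finToFun k′ → k ≡ k′
finToFun-injective {m} {n} {k} {k′} e = begin
  k                                      ≡⟨ Fin.funToFin-finToFin {n} {m} k ⟨
  funToFin {n} {m} (finToFun k)          ≡⟨ funToFin-cong e ⟩
  funToFin {n} {m} (finToFun k′)         ≡⟨ Fin.funToFin-finToFin {n} {m} k′ ⟩
  k′                                     ∎
  where open ≡.≡-Reasoning

2*n≡n+n : ∀ n → 2 ℕ.* n ≡ n ℕ.+ n
2*n≡n+n n = ≡.cong (n ℕ.+_) (ℕ.+-identityʳ n)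

n<m^n : ∀ {m} → 1 ℕ.< m → ∀ n → n ℕ.< m ^ n
n<m^n 1<m zero = s≤s z≤n
n<m^n {m} 1<m (suc n) = ℕ.≤-trans (s≤s (n<m^n 1<m n)) (begin
  suc (m ^ n)         ≤⟨ ℕ.+-monoˡ-≤ (m ^ n) (ℕ.≤-trans (s≤s z≤n) (n<m^n 1<m n)) ⟩
  m ^ n ℕ.+ m ^ n     ≡⟨ 2*n≡n+n (m ^ n) ⟨
  2 ℕ.* m ^ n         ≤⟨ ℕ.*-monoˡ-≤ (m ^ n) 1<m ⟩
  m ℕ.* m ^ n         ∎)
  where open ℕ.≤-Reasoning

prime∣^⇒∣ : ∀ {r m} → Prime r → ∀ e → r ∣ m ^ e → r ∣ m
prime∣^⇒∣ r-prime zero r∣1 = contradiction (≡.subst Prime (∣1⇒≡1 r∣1) r-prime) ¬prime[1]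
prime∣^⇒∣ {m = m} r-prime (suc e) r∣m*m^e =
  [ id , prime∣^⇒∣ r-prime e ]′ (euclidsLemma m (m ^ e) r-prime r∣m*m^e)

prime-power-base-unique : ∀ {r p D e} → Prime r → Prime p → 0 ℕ.< e → r ^ D ≡ p ^ e → r ≡ p
prime-power-base-unique {p = p} {zero} {e} _ p-prime e>0 1≡p^e with ℕ.m^n≡1⇒n≡0∨m≡1 p e (≡.sym 1≡p^e)
... | inj₁ refl = contradiction e>0 (ℕ.<-irrefl refl)
... | inj₂ refl = contradiction p-prime ¬prime[1]
prime-power-base-unique {r} {p} {suc D} {e} r-prime p-prime _ r^D≡p^e
  with prime⇒irreducible p-prime (prime∣^⇒∣ r-prime e (≡.subst (r ∣_) r^D≡p^e (m∣m*n (r ^ D))))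
... | inj₁ refl = contradiction r-prime ¬prime[1]
... | inj₂ r≡p = r≡p

module HasSizeProperties (S : Setoid 0ℓ 0ℓ) where
  open Setoid S

  size-mono : ∀ {P Q : Carrier → Set} {a b} → HasSize _≈_ P a → HasSize _≈_ Q b →
              (∀ x → P x → Q x) → a ≤ b
  size-mono {a = a} {b} (u , u∈P , u-inj , _) (v , _ , _ , v-onto) P⊆Q = Fin.injective⇒≤ {f = g} g-injective
    where
    g : Fin a → Fin b
    g i = proj₁ (v-onto (u i) (P⊆Q _ (u∈P i)))
    g-injective : Injective _≡_ _≡_ g
    g-injective {i} {j} e = u-inj i j (trans (proj₂ (v-onto (u i) _))
                              (trans (reflexive (≡.cong v e)) (sym (proj₂ (v-onto (u j) _)))))

  size-unique : ∀ {P Q : Carrier → Set} {a b} → HasSize _≈_ P a → HasSize _≈_ Q b →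
                (∀ x → P x → Q x) → (∀ x → Q x → P x) → a ≡ b
  size-unique sP sQ P⊆Q Q⊆P = ℕ.≤-antisym (size-mono sP sQ P⊆Q) (size-mono sQ sP Q⊆P)

  size-transport : ∀ {P Q : Carrier → Set} {a} → (∀ x → P x → Q x) → (∀ x → Q x → P x) →
                   HasSize _≈_ P a → HasSize _≈_ Q a
  size-transport P⊆Q Q⊆P (v , v∈P , v-inj , v-onto) = v , (λ i → P⊆Q _ (v∈P i)) , v-inj , λ x → v-onto x ∘ Q⊆P x

module ParabolicProduct (R : CommutativeRing 0ℓ 0ℓ) where
  open CommutativeRing R hiding (zero) renaming (refl to ≈-refl)
  open import Algebra.Properties.Ring ring using (-0#≈0#)
  open Plane R

  record IsAdditiveSubgroup (P : Carrier → Set) : Set where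
    field
      resp : ∀ {x y} → x ≈ y → P x → P y
      0∈ : P 0#
      +∈ : ∀ {x y} → P x → P y → P (x + y)
      -∈ : ∀ {x y} → P x → P y → P (x - y)

  _⊠_ : (Carrier → Set) → (Carrier → Set) → Pt → Set
  (X ⊠ Y) (x , y) = X x × Y y

  ⊠-size : ∀ {X Y a b} → HasSize _≈_ X a → HasSize _≈_ Y b → HasSize _≈Pt_ (X ⊠ Y) (a ℕ.* b)
  ⊠-size {X} {Y} {a} {b} (u , u∈X , u-inj , u-onto) (v , v∈Y , v-inj , v-onto) =
    w , (λ k → u∈X _ , v∈Y _) , w-injective , w-onto
    where
    w : Fin (a ℕ.* b) → Pt
    w k = u (Fin.quotient {a} b k) , v (Fin.remainder {a} b k)
    w-injective : ∀ k k′ → w k ≈Pt w k′ → k ≡ k′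
    w-injective k k′ (e₁ , e₂) = begin
      k                                                           ≡⟨ Fin.combine-remQuot {a} b k ⟨
      combine (Fin.quotient {a} b k) (Fin.remainder {a} b k)      ≡⟨ ≡.cong₂ combine (u-inj _ _ e₁) (v-inj _ _ e₂) ⟩
      combine (Fin.quotient {a} b k′) (Fin.remainder {a} b k′)    ≡⟨ Fin.combine-remQuot {a} b k′ ⟩
      k′                                                          ∎
      where open ≡.≡-Reasoning
    w-onto : ∀ z → (X ⊠ Y) z → ∃ λ k → z ≈Pt w k
    w-onto (x , y) (x∈X , y∈Y) with i , x≈ui ← u-onto x x∈X | j , y≈vj ← v-onto y y∈Y =
      combine i j , ≡.subst (λ ij → x ≈ u (proj₁ ij) × y ≈ v (proj₂ ij)) (≡.sym (Fin.remQuot-combine i j)) (x≈ui , y≈vj)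

  parabolic-product : ∀ {X H a b} → IsAdditiveSubgroup X → IsAdditiveSubgroup H →
    (∀ {x y} → X x → X y → H (x * y)) → HasSize _≈_ X a → HasSize _≈_ H b →
    Respects (X ⊠ H) × MaxColumn (X ⊠ H) b × HasSize _≈Pt_ (X ⊠ H) (a ℕ.* b) × HasSize _≈_ (ΔP (X ⊠ H)) b
  parabolic-product {X} {H} {a} {b} X-subgroup H-subgroup X*X⊆H X-size H-size =
    respects , (column-bound , 0# , column-size) , ⊠-size X-size H-size , distance-size
    where
    module X = IsAdditiveSubgroup X-subgroup
    module H = IsAdditiveSubgroup H-subgroup
    open HasSizeProperties setoid

    respects : Respects (X ⊠ H)
    respects _ _ (e₁ , e₂) (x∈X , y∈H) = X.resp e₁ x∈X , H.resp e₂ y∈H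

    column-bound : ∀ x n → HasSize _≈_ (Column (X ⊠ H) x) n → n ≤ b
    column-bound x n column = size-mono column H-size (λ _ → proj₂)

    column-size : HasSize _≈_ (Column (X ⊠ H) 0#) b
    column-size = size-transport (λ _ t∈H → X.0∈ , t∈H) (λ _ → proj₂) H-size

    distance∈H : ∀ t → ΔP (X ⊠ H) t → H t
    distance∈H t ((x₁ , x₂) , (y₁ , y₂) , (x₁∈X , x₂∈H) , (y₁∈X , y₂∈H) , d≈t) =
      H.resp d≈t (H.+∈ (H.-∈ x₂∈H y₂∈H) (X*X⊆H (X.-∈ x₁∈X y₁∈X) (X.-∈ x₁∈X y₁∈X)))

    H⊆distances : ∀ t → H t → ΔP (X ⊠ H) t
    H⊆distances t t∈H = (0# , t) , (0# , 0#) , (X.0∈ , t∈H) , (X.0∈ , H.0∈) , (begin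
      (t - 0#) + (0# - 0#) * (0# - 0#)   ≈⟨ +-cong (+-congˡ -0#≈0#) (trans (*-congʳ (-‿inverseʳ 0#)) (zeroˡ _)) ⟩
      (t + 0#) + 0#                      ≈⟨ +-identityʳ _ ⟩
      t + 0#                             ≈⟨ +-identityʳ t ⟩
      t                                  ∎)
      where open import Relation.Binary.Reasoning.Setoid setoid

    distance-size : HasSize _≈_ (ΔP (X ⊠ H)) b
    distance-size = size-transport H⊆distances distance∈H H-size

module Polynomial (R : CommutativeRing 0ℓ 0ℓ) where
  open CommutativeRing R hiding (zero) renaming (refl to ≈-refl)
  open import Algebra.Properties.Ring ring using (//-rightDividesˡ; x∙y⁻¹≈ε⇒x≈y)
  open import Algebra.Solver.Ring.NaturalCoefficients.Default commutativeSemiring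
  open import Relation.Binary.Reasoning.Setoid setoid

  eval : ∀ {m} → (Fin m → Carrier) → Carrier → Carrier
  eval {zero} f x = 0#
  eval {suc m} f x = f zero + x * eval (f ∘ suc) x

  -- The coefficients of (x · f(x) − t · f(t)) / (x − t).
  quotient : ∀ {m} → Carrier → (Fin m → Carrier) → Fin m → Carrier
  quotient t f zero = eval f t
  quotient t f (suc i) = quotient t (f ∘ suc) i

  -- Stated with s ≈ t + d rather than d = s − t so that the inductive step is a semiring identity.
  eval-division : ∀ {m} (f : Fin m → Carrier) {s t d} → s ≈ t + d →
                  s * eval f s ≈ t * eval f t + d * eval (quotient t f) s
  eval-division {zero} f {s} {t} {d} _ = begin
    s * 0#            ≈⟨ zeroʳ s ⟩
    0#                ≈⟨ +-identityʳ 0# ⟨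
    0# + 0#           ≈⟨ +-cong (zeroʳ t) (zeroʳ d) ⟨
    t * 0# + d * 0#   ∎
  eval-division {suc m} f {s} {t} {d} s≈t+d = begin
    s * (c + s * A)                                     ≈⟨ *-congˡ (+-congˡ (eval-division (f ∘ suc) s≈t+d)) ⟩
    s * (c + (t * B + d * Q))                           ≈⟨ *-congʳ s≈t+d ⟩
    (t + d) * (c + (t * B + d * Q))                     ≈⟨ expand t d c B Q ⟩
    t * (c + t * B) + d * ((c + t * B) + (t + d) * Q)   ≈⟨ +-congˡ (*-congˡ (+-congˡ (*-congʳ s≈t+d))) ⟨
    t * (c + t * B) + d * ((c + t * B) + s * Q)         ∎
    where
    c A B Q : Carrier
    c = f zero
    A = eval (f ∘ suc) s
    B = eval (f ∘ suc) t
    Q = eval (quotient t (f ∘ suc)) s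
    expand : ∀ t d c B Q → (t + d) * (c + (t * B + d * Q)) ≈ t * (c + t * B) + d * ((c + t * B) + (t + d) * Q)
    expand = solve 5 (λ t d c B Q → (t :+ d) :* (c :+ (t :* B :+ d :* Q)) :=
                                     t :* (c :+ t :* B) :+ d :* ((c :+ t :* B) :+ (t :+ d) :* Q)) ≈-refl

  constant-term-zero : ∀ {c x e} → e ≈ 0# → c + x * e ≈ 0# → c ≈ 0#
  constant-term-zero {c} {x} {e} e≈0 c+xe≈0 = begin
    c                 ≈⟨ +-identityʳ c ⟨
    c + 0#            ≈⟨ +-congˡ (trans (*-congˡ e≈0) (zeroʳ x)) ⟨
    c + x * e         ≈⟨ c+xe≈0 ⟩
    0#                ∎

  eval-zero : ∀ {m} (f : Fin m → Carrier) {x} → (∀ i → f i ≈ 0#) → eval f x ≈ 0#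
  eval-zero {zero} f _ = ≈-refl
  eval-zero {suc m} f {x} f≈0 = begin
    f zero + x * eval (f ∘ suc) x   ≈⟨ +-cong (f≈0 zero) (*-congˡ (eval-zero (f ∘ suc) (f≈0 ∘ suc))) ⟩
    0# + x * 0#                     ≈⟨ +-identityˡ _ ⟩
    x * 0#                          ≈⟨ zeroʳ x ⟩
    0#                              ∎

  quotient-zero : ∀ {m} t (f : Fin m → Carrier) → (∀ i → quotient t f i ≈ 0#) → ∀ i → f i ≈ 0#
  quotient-zero t f q≈0 zero = constant-term-zero (eval-zero (f ∘ suc) (quotient-zero t (f ∘ suc) (q≈0 ∘ suc))) (q≈0 zero)
  quotient-zero t f q≈0 (suc i) = quotient-zero t (f ∘ suc) (q≈0 ∘ suc) i

  roots⇒zero : (∀ x y → x * y ≈ 0# → x ≈ 0# ⊎ y ≈ 0#) →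
               ∀ {m} (f t : Fin m → Carrier) → (∀ {i j} → t i ≈ t j → i ≡ j) →
               (∀ i → eval f (t i) ≈ 0#) → ∀ i → f i ≈ 0#
  roots⇒zero no-zero-divisors {suc m} f t t-injective roots = coefficient-zero
    where
    t₀ : Carrier
    t₀ = t zero
    h : Fin m → Carrier
    h = f ∘ suc

    quotient-roots : ∀ j → eval (quotient t₀ h) (t (suc j)) ≈ 0#
    quotient-roots j with no-zero-divisors (s - t₀) _ product≈0
      where
      s Q : Carrier
      s = t (suc j)
      Q = eval (quotient t₀ h) s
      product≈0 : (s - t₀) * Q ≈ 0#
      product≈0 = begin
        (s - t₀) * Q                              ≈⟨ +-identityˡ _ ⟨
        0# + (s - t₀) * Q                         ≈⟨ +-congʳ (roots zero) ⟨
        (f zero + t₀ * eval h t₀) + (s - t₀) * Q  ≈⟨ +-assoc _ _ _ ⟩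
        f zero + (t₀ * eval h t₀ + (s - t₀) * Q)  ≈⟨ +-congˡ (eval-division h (trans (sym (//-rightDividesˡ t₀ s)) (+-comm _ _))) ⟨
        f zero + s * eval h s                     ≈⟨ roots (suc j) ⟩
        0#                                        ∎
    ... | inj₁ s-t₀≈0 with () ← t-injective (x∙y⁻¹≈ε⇒x≈y _ _ s-t₀≈0)
    ... | inj₂ Q≈0 = Q≈0

    h≈0 : ∀ i → h i ≈ 0#
    h≈0 = quotient-zero t₀ h (roots⇒zero no-zero-divisors (quotient t₀ h) (t ∘ suc) (Fin.suc-injective ∘ t-injective) quotient-roots)

    coefficient-zero : ∀ i → f i ≈ 0#
    coefficient-zero zero = constant-term-zero (eval-zero h h≈0) (roots zero)
    coefficient-zero (suc i) = h≈0 i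

module Multiples (R : CommutativeRing 0ℓ 0ℓ) where
  open CommutativeRing R hiding (zero)
  open import Algebra.Properties.Ring ring using (+-cancelˡ)
  open import Algebra.Properties.Semiring.Mult semiring renaming (_×_ to _·_)
  open import Algebra.Properties.CommutativeMonoid.Mult +-commutativeMonoid using (×-distrib-+)
  open import Algebra.Properties.CommutativeMonoid.Sum +-commutativeMonoid using (sum)
  open import Relation.Binary.Reasoning.Setoid setoid

  ·-zeroʳ : ∀ n → n · 0# ≈ 0#
  ·-zeroʳ n = begin
    n · 0#            ≈⟨ ×-congʳ n (zeroˡ 1#) ⟨
    n · (0# * 1#)     ≈⟨ ×-comm-* n 0# 1# ⟨
    0# * (n · 1#)     ≈⟨ zeroˡ _ ⟩
    0#                ∎

  ·≈·1* : ∀ a x → a · x ≈ (a · 1#) * x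
  ·≈·1* a x = begin
    a · x             ≈⟨ ×-congʳ a (*-identityˡ x) ⟨
    a · (1# * x)      ≈⟨ ×-assoc-* a 1# x ⟨
    (a · 1#) * x      ∎

  ·-distrib-sum : ∀ {d} m (f : Fin d → Carrier) → m · sum f ≈ sum (λ i → m · f i)
  ·-distrib-sum {zero} m f = ·-zeroʳ m
  ·-distrib-sum {suc d} m f = trans (×-distrib-+ (f zero) (sum (f ∘ suc)) m) (+-congˡ (·-distrib-sum m (f ∘ suc)))

  ·1-difference : ∀ {a b} → a ≤ b → a · 1# ≈ b · 1# → (b ∸ a) · 1# ≈ 0#
  ·1-difference {a} {b} a≤b a≈b = +-cancelˡ (a · 1#) _ _ (begin
    a · 1# + (b ∸ a) · 1#   ≈⟨ ×-homo-+ 1# a (b ∸ a) ⟨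
    (a ℕ.+ (b ∸ a)) · 1#    ≡⟨ ≡.cong (_· 1#) (ℕ.m+[n∸m]≡n a≤b) ⟩
    b · 1#                  ≈⟨ a≈b ⟨
    a · 1#                  ≈⟨ +-identityʳ _ ⟨
    a · 1# + 0#             ∎)

module FiniteField (F : CommutativeRing 0ℓ 0ℓ) (isField : IsField F) {q : ℕ} (card : HasCard F q) where
  open import Data.Nat using (_<_)
  open CommutativeRing F hiding (zero) renaming (refl to ≈-refl)
  open import Algebra.Properties.Ring ring
  open import Algebra.Properties.Semiring.Mult semiring renaming (_×_ to _·_)
  open import Algebra.Properties.CommutativeMonoid.Sum +-commutativeMonoid
  open import Algebra.Properties.Semiring.Sum semiring using (*-distribˡ-sum)
  open HasSizeProperties setoid
  open ParabolicProduct F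
  open Polynomial F
  open Multiples F
  open Plane F
  open import Relation.Binary.Reasoning.Setoid setoid

  private
    elementAt : Fin q → Carrier
    elementAt = proj₁ card

    indexOf : Carrier → Fin q
    indexOf x = proj₁ (proj₂ (proj₂ card) x)

    ≈elementAt-indexOf : ∀ x → x ≈ elementAt (indexOf x)
    ≈elementAt-indexOf x = proj₂ (proj₂ (proj₂ card) x)

    elementAt-injective : ∀ {i j} → elementAt i ≈ elementAt j → i ≡ j
    elementAt-injective = proj₁ (proj₂ card) _ _

    indexOf-injective : ∀ {x y} → indexOf x ≡ indexOf y → x ≈ y
    indexOf-injective {x} {y} e = trans (≈elementAt-indexOf x) (trans (reflexive (≡.cong elementAt e)) (sym (≈elementAt-indexOf y)))

  field-size : HasSize _≈_ (λ _ → ⊤) q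
  field-size = elementAt , (λ _ → tt) , proj₁ (proj₂ card) , λ x _ → indexOf x , ≈elementAt-indexOf x

  infix 4 _≟_
  _≟_ : Decidable _≈_
  x ≟ y with indexOf x Fin.≟ indexOf y
  ... | yes e = yes (indexOf-injective e)
  ... | no ne = no λ x≈y → ne (elementAt-injective
                  (trans (sym (≈elementAt-indexOf x)) (trans x≈y (≈elementAt-indexOf y))))

  1≉0 : ¬ 1# ≈ 0#
  1≉0 = proj₁ isField

  x*y≈0⇒x≈0∨y≈0 : ∀ x y → x * y ≈ 0# → x ≈ 0# ⊎ y ≈ 0#
  x*y≈0⇒x≈0∨y≈0 x y xy≈0 with x ≟ 0#
  ... | yes x≈0 = inj₁ x≈0
  ... | no x≉0 with x⁻¹ , xx⁻¹≈1 ← proj₂ isField x x≉0 = inj₂ (begin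
    y                 ≈⟨ *-identityˡ y ⟨
    1# * y            ≈⟨ *-congʳ (trans (sym xx⁻¹≈1) (*-comm x x⁻¹)) ⟩
    (x⁻¹ * x) * y     ≈⟨ *-assoc x⁻¹ x y ⟩
    x⁻¹ * (x * y)     ≈⟨ *-congˡ xy≈0 ⟩
    x⁻¹ * 0#          ≈⟨ zeroʳ x⁻¹ ⟩
    0#                ∎)

  positive-characteristic : ∃ λ s → 0 < s × s · 1# ≈ 0#
  positive-characteristic with i , j , i<j , same-index ← Fin.pigeonhole (ℕ.n<1+n q) (λ i → indexOf (toℕ {suc q} i · 1#)) =
    toℕ j ∸ toℕ i , ℕ.m<n⇒0<n∸m i<j , ·1-difference (ℕ.<⇒≤ i<j) (indexOf-injective same-index)

  prime-characteristic : ∃ λ r → Prime r × r · 1# ≈ 0#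
  prime-characteristic with s , s>0 , s≈0 ← positive-characteristic = <-rec _ prime-factor s s>0 s≈0
    where
    Goal : ℕ → Set
    Goal s = 0 < s → s · 1# ≈ 0# → ∃ λ r → Prime r × r · 1# ≈ 0#

    prime-factor : ∀ s → (∀ {t} → t < s → Goal t) → Goal s
    prime-factor 1 _ _ 1≈0 = contradiction (trans (sym (×-homo-1 1#)) 1≈0) 1≉0
    prime-factor s@(suc (suc _)) smaller _ s≈0 with prime? s
    ... | yes s-prime = s , s-prime , s≈0
    ... | no s-not-prime with composite {d} d<s (divides e s≡e*d) ← ¬prime⇒composite s-not-prime =
      [ smaller e<s e>0 , smaller d<s (ℕ.<-trans z<s 1<d) ]′
        (x*y≈0⇒x≈0∨y≈0 _ _ (trans (sym (×1-homo-* e d)) (trans (reflexive (≡.cong (_· 1#) (≡.sym s≡e*d))) s≈0)))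
      where
      1<d : 1 < d
      1<d = ℕ.nonTrivial⇒n>1 d
      e>0 : 0 < e
      e>0 = ℕ.n≢0⇒n>0 λ { refl → ℕ.0≢1+n (≡.sym s≡e*d) }
      e<s : e < s
      e<s = ≡.subst (e <_) (≡.sym s≡e*d) (ℕ.m<m*n e d {{ℕ.>-nonZero e>0}} 1<d)

  module PrimeSubfield {r : ℕ} (r-prime : Prime r) (r·1≈0 : r · 1# ≈ 0#) where
    instance
      r-nonZero : ℕ.NonZero r
      r-nonZero = prime⇒nonZero r-prime

    1<r : 1 < r
    1<r = ℕ.nonTrivial⇒n>1 r {{prime⇒nonTrivial r-prime}}

    ∣⇒·≈0 : ∀ {a} → r ∣ a → ∀ x → a · x ≈ 0#
    ∣⇒·≈0 (divides m refl) x = begin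
      (m ℕ.* r) · x        ≡⟨ ≡.cong (_· x) (ℕ.*-comm m r) ⟩
      (r ℕ.* m) · x        ≈⟨ ×-assocˡ x r m ⟨
      r · (m · x)          ≈⟨ ·≈·1* r (m · x) ⟩
      (r · 1#) * (m · x)   ≈⟨ *-congʳ r·1≈0 ⟩
      0# * (m · x)         ≈⟨ zeroˡ _ ⟩
      0#                   ∎

    ·-mod : ∀ a x → (a % r) · x ≈ a · x
    ·-mod a x = begin
      (a % r) · x                              ≈⟨ +-identityʳ _ ⟨
      (a % r) · x + 0#                         ≈⟨ +-congˡ (∣⇒·≈0 (divides (a ℕ./ r) refl) x) ⟨
      (a % r) · x + ((a ℕ./ r) ℕ.* r) · x      ≈⟨ ×-homo-+ x (a % r) _ ⟨
      (a % r ℕ.+ (a ℕ./ r) ℕ.* r) · x          ≡⟨ ≡.cong (_· x) (m≡m%n+[m/n]*n a r) ⟨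
      a · x                                    ∎

    ·-neg : ∀ x → (r ∸ 1) · x ≈ - x
    ·-neg x = +-inverseˡ-unique _ x (begin
      (r ∸ 1) · x + x          ≈⟨ +-congˡ (×-homo-1 x) ⟨
      (r ∸ 1) · x + 1 · x      ≈⟨ ×-homo-+ x (r ∸ 1) 1 ⟨
      (r ∸ 1 ℕ.+ 1) · x        ≡⟨ ≡.cong (_· x) (ℕ.m∸n+n≡m (ℕ.<⇒≤ 1<r)) ⟩
      r · x                    ≈⟨ ∣⇒·≈0 ∣-refl x ⟩
      0#                       ∎)

    ·-inverse : ∀ {a} → ¬ r ∣ a → ∃ λ u → ∀ x → u · (a · x) ≈ x
    ·-inverse {a} r∤a with coprime-Bézout coprime
      where
      coprime : Coprime a r
      coprime (d∣a , d∣r) with prime⇒irreducible r-prime d∣r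
      ... | inj₁ d≡1 = d≡1
      ... | inj₂ refl = contradiction d∣a r∤a
    ... | Bézout.+- u v 1+vr≡ua = u , λ x → begin
      u · (a · x)              ≈⟨ ×-assocˡ x u a ⟩
      (u ℕ.* a) · x            ≡⟨ ≡.cong (_· x) 1+vr≡ua ⟨
      (1 ℕ.+ v ℕ.* r) · x      ≈⟨ ×-homo-+ x 1 (v ℕ.* r) ⟩
      1 · x + (v ℕ.* r) · x    ≈⟨ +-cong (×-homo-1 x) (∣⇒·≈0 (divides v refl) x) ⟩
      x + 0#                   ≈⟨ +-identityʳ x ⟩
      x                        ∎
    ... | Bézout.-+ u v 1+ua≡vr = (r ∸ 1) ℕ.* u , λ x → begin
      ((r ∸ 1) ℕ.* u) · (a · x)   ≈⟨ ×-assocˡ (a · x) (r ∸ 1) u ⟨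
      (r ∸ 1) · (u · (a · x))     ≈⟨ ·-neg _ ⟩
      - (u · (a · x))             ≈⟨ -‿cong (+-inverseʳ-unique x _ (x+ua·x≈0 x)) ⟩
      - - x                       ≈⟨ -‿involutive x ⟩
      x                           ∎
      where
      x+ua·x≈0 : ∀ x → x + u · (a · x) ≈ 0#
      x+ua·x≈0 x = begin
        x + u · (a · x)          ≈⟨ +-cong (sym (×-homo-1 x)) (×-assocˡ x u a) ⟩
        1 · x + (u ℕ.* a) · x    ≈⟨ ×-homo-+ x 1 (u ℕ.* a) ⟨
        (1 ℕ.+ u ℕ.* a) · x      ≡⟨ ≡.cong (_· x) 1+ua≡vr ⟩
        (v ℕ.* r) · x            ≈⟨ ∣⇒·≈0 (divides v refl) x ⟩
        0#                       ∎

    ·1≈0⇒∣ : ∀ {a} → a · 1# ≈ 0# → r ∣ a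
    ·1≈0⇒∣ {a} a·1≈0 with r ∣? a
    ... | yes r∣a = r∣a
    ... | no r∤a with u , inverse ← ·-inverse r∤a = contradiction (begin
      1#               ≈⟨ inverse 1# ⟨
      u · (a · 1#)     ≈⟨ ×-congʳ u a·1≈0 ⟩
      u · 0#           ≈⟨ ·-zeroʳ u ⟩
      0#               ∎) 1≉0

    ·1≈0⇒≡0 : ∀ {d} → d < r → d · 1# ≈ 0# → d ≡ 0
    ·1≈0⇒≡0 {zero} _ _ = refl
    ·1≈0⇒≡0 {suc d} d<r d·1≈0 = contradiction (·1≈0⇒∣ d·1≈0) (>⇒∤ d<r)

    ·1-injective-≤ : ∀ {a b} → a ≤ b → b < r → a · 1# ≈ b · 1# → a ≡ b
    ·1-injective-≤ {a} {b} a≤b b<r a≈b =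
      ℕ.≤-antisym a≤b (ℕ.m∸n≡0⇒m≤n (·1≈0⇒≡0 (ℕ.≤-<-trans (ℕ.m∸n≤m b a) b<r) (·1-difference a≤b a≈b)))

    ·1-injective : ∀ {a b} → a < r → b < r → a · 1# ≈ b · 1# → a ≡ b
    ·1-injective {a} {b} a<r b<r a≈b with ℕ.≤-total a b
    ... | inj₁ a≤b = ·1-injective-≤ a≤b b<r a≈b
    ... | inj₂ b≤a = ≡.sym (·1-injective-≤ b≤a a<r (sym a≈b))

    -- Linear combinations over the prime field, with natural-number coefficients acting by _·_;
    -- only their residues modulo r matter (lc-mod).
    lc : ∀ {d} → (Fin d → ℕ) → (Fin d → Carrier) → Carrier
    lc {d} c L = ∑[ i < d ] (c i · L i)

    lc-cong : ∀ {d} (L : Fin d → Carrier) {c c′} → c ≗ c′ → lc c L ≈ lc c′ L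
    lc-cong L c≗c′ = reflexive (sum-cong-≗ (λ i → ≡.cong (_· L i) (c≗c′ i)))

    lc-zero : ∀ {d} (L : Fin d → Carrier) → lc (λ _ → 0) L ≈ 0#
    lc-zero {d} L = sum-replicate-zero d

    lc-+ : ∀ {d} (L : Fin d → Carrier) c c′ → lc (λ i → c i ℕ.+ c′ i) L ≈ lc c L + lc c′ L
    lc-+ L c c′ = trans (sum-cong-≋ (λ i → ×-homo-+ (L i) (c i) (c′ i))) (∑-distrib-+ (λ i → c i · L i) (λ i → c′ i · L i))

    lc-· : ∀ {d} (L : Fin d → Carrier) m c → lc (λ i → m ℕ.* c i) L ≈ m · lc c L
    lc-· L m c = trans (sum-cong-≋ (λ i → sym (×-assocˡ (L i) m (c i)))) (sym (·-distrib-sum m (λ i → c i · L i)))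

    lc-* : ∀ {d} (L : Fin d → Carrier) c x → lc c (λ i → x * L i) ≈ x * lc c L
    lc-* L c x = trans (sum-cong-≋ (λ i → sym (×-comm-* (c i) x (L i)))) (sym (*-distribˡ-sum x (λ i → c i · L i)))

    lc-mod : ∀ {d} (L : Fin d → Carrier) c → lc (λ i → c i % r) L ≈ lc c L
    lc-mod L c = sum-cong-≋ (λ i → ·-mod (c i) (L i))

    record Span {d} (L : Fin d → Carrier) (x : Carrier) : Set where
      constructor span
      field
        coefficients : Fin d → ℕ
        combination : lc coefficients L ≈ x

    module _ {d} {L : Fin d → Carrier} where
      Span-cong : ∀ {x y} → x ≈ y → Span L x → Span L y
      Span-cong x≈y (span c e) = span c (trans e x≈y)

      Span-0 : Span L 0#
      Span-0 = span (λ _ → 0) (lc-zero L)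

      Span-+ : ∀ {x y} → Span L x → Span L y → Span L (x + y)
      Span-+ (span c e) (span c′ e′) = span (λ i → c i ℕ.+ c′ i) (trans (lc-+ L c c′) (+-cong e e′))

      Span-· : ∀ m {x} → Span L x → Span L (m · x)
      Span-· m (span c e) = span (λ i → m ℕ.* c i) (trans (lc-· L m c) (×-congʳ m e))

      Span-sub : ∀ {x y} → Span L x → Span L y → Span L (x - y)
      Span-sub sx sy = Span-+ sx (Span-cong (·-neg _) (Span-· (r ∸ 1) sy))

      Span-∷ : ∀ {w x} → Span L x → Span (w ∷ L) x
      Span-∷ (span c e) = span (0 ∷ c) (trans (+-identityˡ _) e)

      Span-head : ∀ {w} → Span (w ∷ L) w
      Span-head {w} = span (1 ∷ λ _ → 0) (trans (+-cong (+-identityʳ w) (lc-zero L)) (+-identityʳ w))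

    Span-⊆ : ∀ {d e} {L : Fin d → Carrier} {L′ : Fin e → Carrier} →
             (∀ i → Span L′ (L i)) → ∀ {x} → Span L x → Span L′ x
    Span-⊆ {zero} _ (span c e) = Span-cong e Span-0
    Span-⊆ {suc d} L⊆ (span c e) =
      Span-cong e (Span-+ (Span-· (c zero) (L⊆ zero)) (Span-⊆ (L⊆ ∘ suc) (span (c ∘ suc) ≈-refl)))

    Independent : ∀ {d} → (Fin d → Carrier) → Set
    Independent L = ∀ c → lc c L ≈ 0# → ∀ i → c i · 1# ≈ 0#

    Independent-∷ : ∀ {d} {L : Fin d → Carrier} {w} → Independent L → ¬ Span L w → Independent (w ∷ L)
    Independent-∷ {L = L} {w} independent w∉L c relation with c zero · 1# ≟ 0#
    ... | yes c₀≈0 = λ { zero → c₀≈0 ; (suc i) → independent (c ∘ suc) rest≈0 i }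
      where
      rest≈0 : lc (c ∘ suc) L ≈ 0#
      rest≈0 = begin
        lc (c ∘ suc) L                   ≈⟨ +-identityˡ _ ⟨
        0# + lc (c ∘ suc) L              ≈⟨ +-congʳ (trans (·≈·1* (c zero) w) (trans (*-congʳ c₀≈0) (zeroˡ w))) ⟨
        c zero · w + lc (c ∘ suc) L      ≈⟨ relation ⟩
        0#                               ∎
    ... | no c₀≉0 with u , inverse ← ·-inverse {c zero} (λ r∣c₀ → c₀≉0 (∣⇒·≈0 r∣c₀ 1#)) =
      contradiction (Span-cong (inverse w) (Span-· u (Span-cong c₀w≈-rest (Span-· (r ∸ 1) (span (c ∘ suc) ≈-refl))))) w∉L
      where
      c₀w≈-rest : (r ∸ 1) · lc (c ∘ suc) L ≈ c zero · w
      c₀w≈-rest = trans (·-neg _) (sym (+-inverseˡ-unique _ _ relation))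

    digits : ∀ {d} → Fin (r ^ d) → Fin d → ℕ
    digits k i = toℕ (finToFun k i)

    reduce : ∀ {d} → (Fin d → ℕ) → Fin (r ^ d)
    reduce c = funToFin (λ i → fromℕ< (m%n<n (c i) r))

    digits-reduce : ∀ {d} (c : Fin d → ℕ) i → digits (reduce c) i ≡ c i % r
    digits-reduce c i = ≡.trans (≡.cong toℕ (Fin.finToFun-funToFin _ i)) (Fin.toℕ-fromℕ< _)

    lc-reduce : ∀ {d} (L : Fin d → Carrier) c → lc (digits (reduce c)) L ≈ lc c L
    lc-reduce L c = trans (lc-cong L (digits-reduce c)) (lc-mod L c)

    span-size : ∀ {d} {L : Fin d → Carrier} → Independent L → HasSize _≈_ (Span L) (r ^ d)
    span-size {L = L} independent =
      (λ k → lc (digits k) L) , (λ k → span (digits k) ≈-refl) , injective ,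
      λ { x (span c e) → reduce c , trans (sym e) (sym (lc-reduce L c)) }
      where
      injective : ∀ k k′ → lc (digits k) L ≈ lc (digits k′) L → k ≡ k′
      injective k k′ e = finToFun-injective λ i →
        Fin.toℕ-injective (·1-injective (Fin.toℕ<n _) (Fin.toℕ<n _) (same-digit i))
        where
        difference≈0 : lc (λ i → digits k i ℕ.+ (r ∸ 1) ℕ.* digits k′ i) L ≈ 0#
        difference≈0 = begin
          lc (λ i → digits k i ℕ.+ (r ∸ 1) ℕ.* digits k′ i) L            ≈⟨ lc-+ L (digits k) (λ i → (r ∸ 1) ℕ.* digits k′ i) ⟩
          lc (digits k) L + lc (λ i → (r ∸ 1) ℕ.* digits k′ i) L        ≈⟨ +-cong e (lc-· L (r ∸ 1) _) ⟩
          lc (digits k′) L + (r ∸ 1) · lc (digits k′) L                 ≈⟨ +-congˡ (·-neg _) ⟩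
          lc (digits k′) L - lc (digits k′) L                           ≈⟨ -‿inverseʳ _ ⟩
          0#                                                           ∎
        same-digit : ∀ i → digits k i · 1# ≈ digits k′ i · 1#
        same-digit i = x∙y⁻¹≈ε⇒x≈y _ _ (begin
          digits k i · 1# - digits k′ i · 1#                   ≈⟨ +-congˡ (·-neg _) ⟨
          digits k i · 1# + (r ∸ 1) · (digits k′ i · 1#)       ≈⟨ +-congˡ (×-assocˡ 1# (r ∸ 1) _) ⟩
          digits k i · 1# + ((r ∸ 1) ℕ.* digits k′ i) · 1#     ≈⟨ ×-homo-+ 1# (digits k i) _ ⟨
          (digits k i ℕ.+ (r ∸ 1) ℕ.* digits k′ i) · 1#        ≈⟨ independent (λ i → digits k i ℕ.+ (r ∸ 1) ℕ.* digits k′ i) difference≈0 i ⟩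
          0#                                                   ∎)

    Span? : ∀ {d} (L : Fin d → Carrier) x → Dec (Span L x)
    Span? L x with Fin.any? (λ k → lc (digits k) L ≟ x)
    ... | yes (k , e) = yes (span (digits k) e)
    ... | no ∄ = no λ { (span c e) → ∄ (reduce c , trans (lc-reduce L c) e) }

    NontrivialRelation : ∀ {d} → (Fin d → Carrier) → Fin (r ^ d) → Set
    NontrivialRelation {d} L k = lc (digits k) L ≈ 0# × ∃ λ (i : Fin d) → ¬ digits k i · 1# ≈ 0#

    independent-or-relation : ∀ {d} (L : Fin d → Carrier) → Independent L ⊎ ∃ (NontrivialRelation L)
    independent-or-relation {d} L
      with Fin.any? {n = r ^ d} (λ k → (lc (digits k) L ≟ 0#) ×-dec Fin.any? {n = d} (λ i → ¬? (digits k i · 1# ≟ 0#)))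
    ... | yes relation = inj₂ relation
    ... | no ∄ = inj₁ vanishing
      where
      vanishing : Independent L
      vanishing c e i with c i · 1# ≟ 0#
      ... | yes c≈0 = c≈0
      ... | no c≉0 = contradiction (reduce c , trans (lc-reduce L c) e , i , c≉0 ∘ reduced) ∄
        where
        reduced : digits (reduce c) i · 1# ≈ 0# → c i · 1# ≈ 0#
        reduced z = trans (sym (·-mod (c i) 1#)) (trans (reflexive (≡.cong (_· 1#) (≡.sym (digits-reduce c i)))) z)

    Independent? : ∀ {d} (L : Fin d → Carrier) → Dec (Independent L)
    Independent? L with independent-or-relation L
    ... | inj₁ independent = yes independent
    ... | inj₂ (k , e , i , nonzero) = no λ independent → nonzero (independent (digits k) e i)

    spans-or-misses : ∀ {d} (L : Fin d → Carrier) → (∀ x → Span L x) ⊎ ∃ λ w → ¬ Span L w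
    spans-or-misses L with Fin.all? (λ i → Span? L (elementAt i))
    ... | yes all = inj₁ λ x → Span-cong (sym (≈elementAt-indexOf x)) (all (indexOf x))
    ... | no ¬all with i , i∉ ← Fin.¬∀⟶∃¬ q _ (λ i → Span? L (elementAt i)) ¬all = inj₂ (elementAt i , i∉)

    independent⇒r^d≤q : ∀ {d} {L : Fin d → Carrier} → Independent L → r ^ d ≤ q
    independent⇒r^d≤q independent = size-mono (span-size independent) field-size (λ _ _ → tt)

    spanning⇒r^d≡q : ∀ {d} {L : Fin d → Carrier} → Independent L → (∀ x → Span L x) → r ^ d ≡ q
    spanning⇒r^d≡q independent spanning = size-unique (span-size independent) field-size (λ _ _ → tt) (λ x _ → spanning x)

    exists-outside : ∀ {d} {L : Fin d → Carrier} → Independent L → r ^ d < q → ∃ λ w → ¬ Span L w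
    exists-outside {L = L} independent r^d<q with spans-or-misses L
    ... | inj₁ spanning = contradiction (spanning⇒r^d≡q independent spanning) (ℕ.<⇒≢ r^d<q)
    ... | inj₂ outside = outside

    card-is-power : ∃ λ D → r ^ D ≡ q
    card-is-power = grow (suc q) {0} (λ ()) (λ _ _ ()) (ℕ.n<1+n q)
      where
      -- An independent family of length d spans r^d ≤ q elements, so d < q bounds the growth.
      grow : ∀ fuel {d} (L : Fin d → Carrier) → Independent L → q < d ℕ.+ fuel → ∃ λ D → r ^ D ≡ q
      grow fuel {d} L independent q<d+fuel with spans-or-misses L
      ... | inj₁ spanning = d , spanning⇒r^d≡q independent spanning
      grow zero {d} L independent q<d+0 | inj₂ _ = contradiction
        (ℕ.<-trans (ℕ.<-≤-trans (n<m^n 1<r d) (independent⇒r^d≤q independent)) (≡.subst (q <_) (ℕ.+-identityʳ d) q<d+0))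
        (ℕ.<-irrefl refl)
      grow (suc fuel) {d} L independent q<d+fuel | inj₂ (w , w∉L) =
        grow fuel (w ∷ L) (Independent-∷ independent w∉L) (≡.subst (q <_) (ℕ.+-suc d fuel) q<d+fuel)

    independent-span-⊇ : ∀ {e} (W : Fin e → Carrier) → r ^ e ≤ q →
      ∃ λ (L : Fin e → Carrier) → Independent L × (∀ i → Span L (W i))
    independent-span-⊇ {zero} W _ = (λ ()) , (λ _ _ ()) , λ ()
    independent-span-⊇ {suc e} W r^e≤q
      with L , independent , W⊆L ← independent-span-⊇ (W ∘ suc) (ℕ.≤-trans (ℕ.^-monoʳ-≤ r (ℕ.n≤1+n e)) r^e≤q)
      with Span? L (W zero)
    ... | no W₀∉L = W zero ∷ L , Independent-∷ independent W₀∉L , λ { zero → Span-head ; (suc i) → Span-∷ (W⊆L i) }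
    ... | yes W₀∈L with u , u∉L ← exists-outside independent (ℕ.<-≤-trans (ℕ.^-monoʳ-< r 1<r (ℕ.n<1+n e)) r^e≤q) =
      u ∷ L , Independent-∷ independent u∉L , λ { zero → Span-∷ W₀∈L ; (suc i) → Span-∷ (W⊆L i) }

    Span-subgroup : ∀ {d} (L : Fin d → Carrier) → IsAdditiveSubgroup (Span L)
    Span-subgroup L = record { resp = Span-cong ; 0∈ = Span-0 ; +∈ = Span-+ ; -∈ = Span-sub }

    powers : ∀ {n} → Carrier → Fin n → Carrier
    powers θ zero = 1#
    powers θ (suc i) = θ * powers θ i

    lc-powers : ∀ {n} θ (c : Fin n → ℕ) → lc c (powers θ) ≈ eval (λ i → c i · 1#) θ
    lc-powers {zero} θ c = ≈-refl
    lc-powers {suc n} θ c = +-congˡ (trans (lc-* (powers θ) (c ∘ suc) θ) (*-congˡ (lc-powers θ (c ∘ suc))))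

    module _ {θ : Carrier} where
      Span-powers-step : ∀ {m} a {y} → Span (powers {m} θ) y → Span (powers {suc m} θ) (a · 1# + θ * y)
      Span-powers-step a (span c e) = span (a ∷ c) (+-congˡ (trans (lc-* (powers θ) c θ) (*-congˡ e)))

      Span-powers-θ* : ∀ {m y} → Span (powers {m} θ) y → Span (powers {suc m} θ) (θ * y)
      Span-powers-θ* sy = Span-cong (+-identityˡ _) (Span-powers-step 0 sy)

      Span-powers-split : ∀ {m x} → Span (powers {suc m} θ) x →
                          ∃₂ λ a y → Span (powers {m} θ) y × x ≈ a · 1# + θ * y
      Span-powers-split (span c e) =
        c zero , lc (c ∘ suc) (powers θ) , span (c ∘ suc) ≈-refl , trans (sym e) (+-congˡ (lc-* (powers θ) (c ∘ suc) θ))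

      Span-powers-suc : ∀ {m x} → Span (powers {m} θ) x → Span (powers {suc m} θ) x
      Span-powers-suc {zero} (span c e) = Span-cong e Span-0
      Span-powers-suc {suc m} sx with a , y , sy , x≈ ← Span-powers-split sx =
        Span-cong (sym x≈) (Span-powers-step a (Span-powers-suc sy))

      Span-powers-+ : ∀ k {m x} → Span (powers {m} θ) x → Span (powers {k ℕ.+ m} θ) x
      Span-powers-+ zero sx = sx
      Span-powers-+ (suc k) sx = Span-powers-suc (Span-powers-+ k sx)

      Span-powers-* : ∀ a {b x y} → Span (powers {a} θ) x → Span (powers {b} θ) y → Span (powers {a ℕ.+ b} θ) (x * y)
      Span-powers-* zero {x = x} {y} (span c e) sy = Span-cong (trans (sym (zeroˡ y)) (*-congʳ e)) Span-0
      Span-powers-* (suc a) {x = x} {y} sx sy with c , x′ , sx′ , x≈ ← Span-powers-split sx =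
        Span-cong (sym x*y≈) (Span-+ (Span-powers-+ (suc a) (Span-· c sy)) (Span-powers-θ* (Span-powers-* a sx′ sy)))
        where
        x*y≈ : x * y ≈ c · y + θ * (x′ * y)
        x*y≈ = begin
          x * y                          ≈⟨ *-congʳ x≈ ⟩
          (c · 1# + θ * x′) * y          ≈⟨ distribʳ y _ _ ⟩
          (c · 1#) * y + (θ * x′) * y    ≈⟨ +-cong (sym (·≈·1* c y)) (*-assoc θ x′ y) ⟩
          c · y + θ * (x′ * y)           ∎

      Span-powers-square : ∀ {n x y} → Span (powers {n} θ) x → Span (powers {n} θ) y → Span (powers {2 ℕ.* n} θ) (x * y)
      Span-powers-square {n} {x} {y} sx sy =
        ≡.subst (λ j → Span (powers {j} θ) (x * y)) (≡.sym (2*n≡n+n n)) (Span-powers-* n sx sy)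

    -- If no θ works, each θ is a root of the polynomial coded by a nontrivial relation among its
    -- powers; a code has at most n − 1 roots, so q ≤ r^n (n − 1) < r^(2n).
    independent-powers : ∀ n → r ^ (2 ℕ.* n) ≤ q → ∃ λ θ → Independent (powers {n} θ)
    independent-powers zero _ = 0# , λ _ _ ()
    independent-powers n@(suc n′) r^2n≤q with Fin.any? (λ i → Independent? (powers {n} (elementAt i)))
    ... | yes (i , independent) = elementAt i , independent
    ... | no ∄ = contradiction (ℕ.<-≤-trans (ℕ.≤-<-trans q≤r^n*n′ r^n*n′<r^2n) r^2n≤q) (ℕ.<-irrefl refl)
      where
      relation : ∀ i → ∃ (NontrivialRelation (powers {n} (elementAt i)))
      relation i with independent-or-relation (powers {n} (elementAt i))
      ... | inj₁ independent = contradiction (i , independent) ∄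
      ... | inj₂ relation = relation

      code : Fin q → Fin (r ^ n)
      code i = proj₁ (relation i)

      polynomial : Fin (r ^ n) → Fin n → Carrier
      polynomial k j = digits k j · 1#

      root : ∀ i → eval (polynomial (code i)) (elementAt i) ≈ 0#
      root i = trans (sym (lc-powers (elementAt i) (digits {n} (code i)))) (proj₁ (proj₂ (relation i)))

      small-fibres : ∀ g → Injective _≡_ _≡_ g → ¬ (∀ j → code (g j) ≡ code (g zero))
      small-fibres g g-injective same-code with _ , i , nonzero ← proj₂ (relation (g zero)) =
        nonzero (roots⇒zero x*y≈0⇒x≈0∨y≈0 (polynomial (code (g zero))) (elementAt ∘ g) (g-injective ∘ elementAt-injective)
          (λ j → ≡.subst (λ k → eval (polynomial k) (elementAt (g j)) ≈ 0#) (same-code j) (root (g j))) i)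

      q≤r^n*n′ : q ≤ r ^ n ℕ.* n′
      q≤r^n*n′ = fibre-bound code small-fibres

      r^n*n′<r^2n : r ^ n ℕ.* n′ < r ^ (2 ℕ.* n)
      r^n*n′<r^2n = ≡.subst (r ^ n ℕ.* n′ <_) (≡.trans (≡.sym (ℕ.^-distribˡ-+-* r n n)) (≡.cong (r ^_) (≡.sym (2*n≡n+n n))))
        (ℕ.*-monoʳ-< (r ^ n) {{ℕ.m^n≢0 r n}} (ℕ.<-trans (ℕ.n<1+n n′) (n<m^n 1<r n)))

    few-parabolic-distances : ∀ n → r ^ (2 ℕ.* n) ≤ q → ∃ λ (E : Pt → Set) → Respects E ×
      MaxColumn E (r ^ (2 ℕ.* n)) × HasSize _≈Pt_ E (r ^ (3 ℕ.* n)) × HasSize _≈_ (ΔP E) (r ^ (2 ℕ.* n))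
    few-parabolic-distances n r^2n≤q
      with θ , A-independent ← independent-powers n r^2n≤q
      with L , H-independent , powers⊆L ← independent-span-⊇ (powers {2 ℕ.* n} θ) r^2n≤q
      with respects , max-column , E-size , Δ-size ←
        parabolic-product (Span-subgroup (powers θ)) (Span-subgroup L)
          (λ x∈A y∈A → Span-⊆ powers⊆L (Span-powers-square x∈A y∈A))
          (span-size A-independent) (span-size H-independent)
      = Span (powers θ) ⊠ Span L , respects , max-column ,
        ≡.subst (HasSize _≈Pt_ _) (≡.sym (ℕ.^-distribˡ-+-* r n (2 ℕ.* n))) E-size , Δ-size

open import Data.Rational using (ℚ; 0ℚ; 1ℚ; _/_; _<_; _-_; *≤*; NonNegative) renaming (_≤_ to _≤ℚ_; _*_ to _*ℚ_)
import Data.Rational.Properties as ℚ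

/1-cancel-≤ : ∀ {m n} → + m / 1 ≤ℚ + n / 1 → m ≤ n
/1-cancel-≤ {m} {n} le
  rewrite ℚ.normalize-coprime (Coprimality.sym (1-coprimeTo m)) | ℚ.normalize-coprime (Coprimality.sym (1-coprimeTo n))
  with *≤* m*1≤n*1 ← le
  = ℤ.drop‿+≤+ (≡.subst₂ ℤ._≤_ (ℤ.*-identityʳ (+ m)) (ℤ.*-identityʳ (+ n)) m*1≤n*1)

half-bound : ∀ (ε : ℚ) k m n → (1ℚ - ε) *ℚ (+ k / 1) ≤ℚ + 2 / 1 →
  (+ 1 / 2) *ℚ ((1ℚ - ε) *ℚ ((+ k / 1) *ℚ (+ m / 1))) ≡ + n / 1 → n ≤ m
half-bound ε k m n ck≤2 n-def = /1-cancel-≤ (begin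
  + n / 1                                              ≡⟨ ≡.sym n-def ⟩
  ½ *ℚ ((1ℚ - ε) *ℚ ((+ k / 1) *ℚ (+ m / 1)))         ≡⟨ ≡.cong (½ *ℚ_) (≡.sym (ℚ.*-assoc (1ℚ - ε) (+ k / 1) (+ m / 1))) ⟩
  ½ *ℚ (((1ℚ - ε) *ℚ (+ k / 1)) *ℚ (+ m / 1))         ≤⟨ ℚ.*-monoˡ-≤-nonNeg ½ (ℚ.*-monoʳ-≤-nonNeg (+ m / 1) ck≤2) ⟩
  ½ *ℚ ((+ 2 / 1) *ℚ (+ m / 1))                       ≡⟨ ≡.sym (ℚ.*-assoc ½ (+ 2 / 1) (+ m / 1)) ⟩
  (½ *ℚ (+ 2 / 1)) *ℚ (+ m / 1)                       ≡⟨ ℚ.*-identityˡ (+ m / 1) ⟩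
  + m / 1                                              ∎)
  where
  open ℚ.≤-Reasoning
  instance
    m/1-nonNeg : NonNegative (+ m / 1)
    m/1-nonNeg = ℚ.normalize-nonNeg m 1
    ½-nonNeg : NonNegative (+ 1 / 2)
    ½-nonNeg = ℚ.normalize-nonNeg 1 2
  ½ : ℚ
  ½ = + 1 / 2

open import Data.Nat using (_*_)

proposition7p2 : (ε : ℚ) → 0ℚ < ε → ε < 1ℚ →
  (k : ℕ) → 2 ≤ k →
  1ℚ ≤ℚ ((1ℚ - ε) *ℚ (+ k / 1)) → ((1ℚ - ε) *ℚ (+ k / 1)) ≤ℚ (+ 2 / 1) →
  (p : ℕ) → Prime p → p ≢ 2 →
  (m : ℕ) → 1 ≤ m →
  (n : ℕ) → (+ 1 / 2) *ℚ ((1ℚ - ε) *ℚ ((+ k / 1) *ℚ (+ m / 1))) ≡ (+ n / 1) →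
  (F : CommutativeRing 0ℓ 0ℓ) → IsField F → HasCard F (p ^ (k * m)) →
  let open Plane F in
  ∃ λ (E : Pt → Set) → Respects E ×
    MaxColumn E (p ^ (2 * n)) ×
    HasSize _≈Pt_ E (p ^ (3 * n)) ×
    HasSize (CommutativeRing._≈_ F) (ΔP E) (p ^ (2 * n))
proposition7p2 ε _ _ k 2≤k _ ck≤2 p p-prime _ m 1≤m n n-def F isField card
  with r , r-prime , r·1≈0 ← FiniteField.prime-characteristic F isField card
  with D , r^D≡q ← FiniteField.PrimeSubfield.card-is-power F isField card r-prime r·1≈0
  with refl ← prime-power-base-unique {D = D} r-prime p-prime (ℕ.*-mono-≤ (ℕ.≤-trans (s≤s z≤n) 2≤k) 1≤m) r^D≡q
  = FiniteField.PrimeSubfield.few-parabolic-distances F isField card r-prime r·1≈0 n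
      (ℕ.^-monoʳ-≤ p {{prime⇒nonZero p-prime}} (ℕ.*-mono-≤ 2≤k (half-bound ε k m n ck≤2 n-def)))
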